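{- Let $\mathcal{A}$ be a complementary alphabet and $P$ a word of length $2n$ in $\mathcal{A}$. Then the graph $\mathcal{G}_P$ is connected: any two $P$-valid plane trees are joined by a finite sequence of valid local moves.
   Context: A complementary alphabet $\mathcal{A}$ is a finite set in which every letter $B$ has a unique complement $\overline{B}\in\mathcal{A}$, with $\overline{B}\neq B$ and $\overline{\overline{B}}=B$. A plane tree is a rooted tree in which the children of each vertex are linearly ordered. For a plane tree with $n$ edges, label the $2n$ half-edges $1,\dots,2n$ by starting on the left side of the leftmost edge at the root and walking counterclockwise around the tree; each edge is written $e(i,j)$, $i<j$, where $i,j$ label its two sides. For $P=p_1\cdots p_{2n}$, a plane tree with $n$ edges is $P$-valid if $p_i,p_j$ are complements for every edge $e(i,j)$. Local moves on a plane tree $S$, for $i<j<i'<j'$: type 1: if $e(i,j)$ and $e(i',j')$ are edges of $S$ sharing a vertex, replace them by $e(i,j')$ and $e(j,i')$; type 2: if $e(i,j')$ and $e(j,i')$ are edges of $S$ sharing a vertex, replace them by $e(i,j)$ and $e(i',j')$. A local move on a $P$-valid tree is valid if the resulting tree is also $P$-valid. $\mathcal{G}_P$ is the undirected graph whose vertices are the $P$-valid plane trees, with an edge between two trees if one is obtained from the other by a valid local move. -}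

module Defs where

open import Level using (Level; _⊔_) renaming (suc to lsuc)
open import Data.Nat using (ℕ; zero; suc; _+_; _*_; _<_)
open import Data.Fin using (Fin)
open import Data.Vec using (Vec; []; _∷_)
open import Data.List using (List; []; _∷_; _++_; map)
open import Data.List.Membership.Propositional using (_∈_)
open import Data.Maybe using (Maybe; just; nothing)
open import Data.Product using (Σ; _×_; _,_; ∃; ∃-syntax)
open import Data.Sum using (_⊎_)
open import Relation.Binary.PropositionalEquality using (_≡_)
open import Relation.Nullary using (¬_)
open import Function.Bundles using (_↔_; _⇔_)
open import Relation.Binary.Construct.Closure.ReflexiveTransitive using (Star)

record ComplementaryAlphabet (ℓ : Level) : Set (lsuc ℓ) where
  field
    Letter     : Set ℓ
    size       : ℕ
    finite     : Fin size ↔ Letter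
    comp       : Letter → Letter
    comp-invol : ∀ B → comp (comp B) ≡ B
    comp-noFix : ∀ B → ¬ (comp B ≡ B)

-- Plane trees: rooted trees whose children are linearly ordered
-- (rose trees; the list gives the children from left to right).

data PlaneTree : Set where
  node : List PlaneTree → PlaneTree

mutual
  edgeCount : PlaneTree → ℕ
  edgeCount (node ts) = edgeCountF ts

  edgeCountF : List PlaneTree → ℕ
  edgeCountF []       = 0
  edgeCountF (t ∷ ts) = suc (edgeCount t) + edgeCountF ts

-- An edge e(i,j) (i < j the labels of its two sides) together with the
-- identifier of its upper endpoint (parent vertex).  Its lower endpoint
-- (child vertex) is identified by i.  Vertex identifiers: the root is 0,
-- any other vertex is the label of the left side of the edge entering it
-- from above.
record LEdge : Set where
  constructor ledge
  field
    left   : ℕ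
    right  : ℕ
    parent : ℕ

-- Counterclockwise contour walk: labels 1..2n, starting on the left side
-- of the leftmost root edge.  Argument k = number of labels used so far,
-- p = identifier of the current vertex.
mutual
  edgesT : ℕ → ℕ → PlaneTree → List LEdge
  edgesT k p (node ts) = edgesF k p ts

  edgesF : ℕ → ℕ → List PlaneTree → List LEdge
  edgesF k p []       = []
  edgesF k p (t ∷ ts) =
    ledge (suc k) (suc k + suc (2 * edgeCount t)) p
      ∷ edgesT (suc k) (suc k) t
      ++ edgesF (k + 2 * suc (edgeCount t)) p ts

edges : PlaneTree → List LEdge
edges = edgesT 0 0

edgePairs : PlaneTree → List (ℕ × ℕ)
edgePairs T = map (λ e → LEdge.left e , LEdge.right e) (edges T)

ShareVertex : LEdge → LEdge → Set
ShareVertex (ledge i _ p) (ledge i' _ p') =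
  p ≡ p' ⊎ p ≡ i' ⊎ i ≡ p' ⊎ i ≡ i'

_IsEdgeOf_ : ℕ × ℕ → PlaneTree → Set
(i , j) IsEdgeOf S = (i , j) ∈ edgePairs S

Replace : PlaneTree → (a b c d : ℕ × ℕ) → PlaneTree → Set
Replace S a b c d T =
  ∀ x → (x ∈ edgePairs T) ⇔
        ((x ∈ edgePairs S × ¬ x ≡ a × ¬ x ≡ b) ⊎ x ≡ c ⊎ x ≡ d)

EdgesShareVertex : PlaneTree → ℕ × ℕ → ℕ × ℕ → Set
EdgesShareVertex S (i , j) (i' , j') =
  Σ ℕ λ p → Σ ℕ λ p' →
    ledge i j p ∈ edges S × ledge i' j' p' ∈ edges S ×
    ShareVertex (ledge i j p) (ledge i' j' p')

LocalMove : PlaneTree → PlaneTree → Set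
LocalMove S T =
  Σ ℕ λ i → Σ ℕ λ j → Σ ℕ λ i' → Σ ℕ λ j' →
    i < j × j < i' × i' < j' ×
    (  (EdgesShareVertex S (i , j) (i' , j')
          × Replace S (i , j) (i' , j') (i , j') (j , i') T)
     ⊎ (EdgesShareVertex S (i , j') (j , i')
          × Replace S (i , j') (j , i') (i , j) (i' , j') T))

module _ {ℓ : Level} (𝒜 : ComplementaryAlphabet ℓ) where
  open ComplementaryAlphabet 𝒜

  -- 1-based lookup of a letter of a word
  letterAt : ∀ {m} → Vec Letter m → ℕ → Maybe Letter
  letterAt []       _             = nothing
  letterAt (x ∷ xs) zero          = nothing
  letterAt (x ∷ xs) (suc zero)    = just x
  letterAt (x ∷ xs) (suc (suc i)) = letterAt xs (suc i)

  ComplementaryAt : ∀ {m} → Vec Letter m → ℕ → ℕ → Set ℓ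
  ComplementaryAt P i j =
    Σ Letter λ a → Σ Letter λ b →
      letterAt P i ≡ just a × letterAt P j ≡ just b × b ≡ comp a

  Valid : (n : ℕ) → Vec Letter (2 * n) → PlaneTree → Set ℓ
  Valid n P T =
    edgeCount T ≡ n ×
    (∀ {i j} → (i , j) ∈ edgePairs T → ComplementaryAt P i j)

  Adjacent𝒢 : (n : ℕ) → Vec Letter (2 * n) → PlaneTree → PlaneTree → Set ℓ
  Adjacent𝒢 n P S T =
    Valid n P S × Valid n P T × (LocalMove S T ⊎ LocalMove T S)

  Connected𝒢 : (n : ℕ) → Vec Letter (2 * n) → Set ℓ
  Connected𝒢 n P =
    ∀ S T → Valid n P S → Valid n P T → Star (Adjacent𝒢 n P) S T

-- A plane tree is handled through the forest of subtrees of its root, the labels of a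
-- forest being shifted by the number of labels to its left.  The key observation is a
-- rotation: if node (a ++ node c ∷ d) ∷ r is P-valid and p_{k+1}, p_{k+2+2|a|} are
-- complements (k the shift), then node a ∷ (c ++ node d ∷ r) is P-valid and differs from it
-- by a local move of type 2; its one new edge starts at the end of c's edge, whose letter
-- is a complement of a complement of p_{k+1}, and ends where the old root edge ended.
-- With this rotation one shows, by induction on |Y|, that a valid forest X can be completed
-- to a valid forest X ++ W of the size of any valid forest Y starting at the same label
-- with |X| ≤ |Y|.  Now let node a ∷ ts and node b ∷ us be valid with |a| ≤ |b|, and complete
-- a to a ++ W with |a ++ W| = |b|.  If W is empty, connect a to b and ts to us; otherwise
-- connect b to a ++ W, rotate, and connect the remaining forest to ts, each by induction
-- on the number of edges.
module Submission where

open import Defs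
open import Level using (Level; Lift; lift)
open import Data.Nat using (ℕ; suc; _+_; _*_; _≤_; _<_; z≤n; s≤s)
open import Data.Nat.Properties
open import Data.Nat.Induction using (<-wellFounded)
open import Data.Nat.Tactic.RingSolver using (solve-∀; solve)
open import Data.Vec using (Vec)
open import Data.List using (List; []; _∷_; _++_; map)
open import Data.List.Properties using (map-++; ++-assoc)
open import Data.List.Membership.Propositional using (_∈_; _∉_)
open import Data.List.Membership.Propositional.Properties using (∈-++⁺ˡ; ∈-++⁺ʳ; ∈-++⁻; ∈-map⁺; ∈-map⁻)
open import Data.List.Relation.Unary.Any using (here; there)
open import Data.List.Relation.Binary.Disjoint.Propositional using (Disjoint)
open import Data.List.Relation.Binary.Permutation.Propositional using (_↭_; ↭-sym; ↭-trans; ↭-reflexive; prep)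
open import Data.List.Relation.Binary.Permutation.Propositional.Properties using (∈-resp-↭; shift; shifts; ++⁺ˡ; ++⁺ʳ)
open import Data.Product using (Σ; _×_; _,_; proj₁; proj₂)
open import Data.Sum using (_⊎_; inj₁; inj₂)
import Data.Sum as Sum
open import Data.Unit using (⊤)
open import Data.Empty using (⊥-elim)
open import Data.Maybe using (just)
open import Data.Maybe.Properties using (just-injective)
open import Relation.Binary.PropositionalEquality
open import Function using (_∘′_)
open import Function.Bundles using (mk⇔)
open import Induction.WellFounded using (Acc; acc)
open import Relation.Binary.Construct.Closure.ReflexiveTransitive using (Star; ε; _◅_; _◅◅_; gmap; reverse)

size : List PlaneTree → ℕ
size = edgeCountF

size-++ : ∀ xs ys → size (xs ++ ys) ≡ size xs + size ys
size-++ []            ys = refl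
size-++ (node t ∷ xs) ys = begin
  suc (size t) + size (xs ++ ys)    ≡⟨ cong (suc (size t) +_) (size-++ xs ys) ⟩
  suc (size t) + (size xs + size ys) ≡⟨ +-assoc (suc (size t)) (size xs) (size ys) ⟨
  suc (size t) + size xs + size ys   ∎
  where open ≡-Reasoning

child<size : ∀ {x y n} → suc x + y ≡ n → x < n
child<size refl = s≤s (m≤m+n _ _)

rest<size : ∀ {x y n} → suc x + y ≡ n → y < n
rest<size {x} refl = s≤s (m≤n+m _ x)

offset-after-tree : ∀ k t n → k + 2 * suc t + 2 * n ≡ k + 2 * (suc t + n)
offset-after-tree = solve-∀

offset-after-node : ∀ k t → suc (suc k + 2 * t) ≡ k + 2 * suc t
offset-after-node = solve-∀

edgesF-++ : ∀ k p xs ys → edgesF k p (xs ++ ys) ≡ edgesF k p xs ++ edgesF (k + 2 * size xs) p ys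
edgesF-++ k p []            ys = cong (λ k′ → edgesF k′ p ys) (sym (+-identityʳ k))
edgesF-++ k p (node t ∷ xs) ys = cong (ledge (suc k) (suc k + suc (2 * size t)) p ∷_) (begin
  edgesF (suc k) (suc k) t ++ edgesF k′ p (xs ++ ys)
    ≡⟨ cong (edgesF (suc k) (suc k) t ++_) (edgesF-++ k′ p xs ys) ⟩
  edgesF (suc k) (suc k) t ++ edgesF k′ p xs ++ edgesF (k′ + 2 * size xs) p ys
    ≡⟨ cong (λ l → edgesF (suc k) (suc k) t ++ edgesF k′ p xs ++ edgesF l p ys) (offset-after-tree k (size t) (size xs)) ⟩
  edgesF (suc k) (suc k) t ++ edgesF k′ p xs ++ edgesF (k + 2 * size (node t ∷ xs)) p ys
    ≡⟨ ++-assoc (edgesF (suc k) (suc k) t) _ _ ⟨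
  (edgesF (suc k) (suc k) t ++ edgesF k′ p xs) ++ edgesF (k + 2 * size (node t ∷ xs)) p ys ∎)
  where
  open ≡-Reasoning
  k′ = k + 2 * suc (size t)

size-rotate : ∀ a c d r → suc (size a) + size (c ++ node d ∷ r) ≡ suc (size (a ++ node c ∷ d)) + size r
size-rotate a c d r = begin
  suc (size a) + size (c ++ node d ∷ r)                  ≡⟨ cong (suc (size a) +_) (size-++ c (node d ∷ r)) ⟩
  suc (size a) + (size c + (suc (size d) + size r))      ≡⟨ reassociate (size a) (size c) (size d) (size r) ⟩
  suc (size a + (suc (size c) + size d)) + size r        ≡⟨ cong (λ s → suc s + size r) (size-++ a (node c ∷ d)) ⟨
  suc (size (a ++ node c ∷ d)) + size r                  ∎
  where
  open ≡-Reasoning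
  reassociate : ∀ a c d r → suc a + (c + (suc d + r)) ≡ suc (a + (suc c + d)) + r
  reassociate = solve-∀

endpoints : LEdge → ℕ × ℕ
endpoints e = LEdge.left e , LEdge.right e

pairs : List LEdge → List (ℕ × ℕ)
pairs = map endpoints

pairs-edgesF-∷ : ∀ k p t r → pairs (edgesF k p (node t ∷ r)) ≡
  (suc k , suc k + suc (2 * size t)) ∷ pairs (edgesF (suc k) (suc k) t) ++ pairs (edgesF (k + 2 * suc (size t)) p r)
pairs-edgesF-∷ k p t r = cong (_ ∷_) (map-++ endpoints (edgesF (suc k) (suc k) t) _)

pairs-edgesF-++ : ∀ k p xs ys →
  pairs (edgesF k p (xs ++ ys)) ≡ pairs (edgesF k p xs) ++ pairs (edgesF (k + 2 * size xs) p ys)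
pairs-edgesF-++ k p xs ys = trans (cong pairs (edgesF-++ k p xs ys)) (map-++ endpoints (edgesF k p xs) _)

pairs-edgesF-cong : ∀ {k k′} p p′ ts → k ≡ k′ → pairs (edgesF k p ts) ≡ pairs (edgesF k′ p′ ts)
pairs-edgesF-cong p p′ []           refl = refl
pairs-edgesF-cong p p′ (node t ∷ r) refl = begin
  pairs (edgesF _ p (node t ∷ r))  ≡⟨ pairs-edgesF-∷ _ p t r ⟩
  _ ∷ _ ++ pairs (edgesF _ p r)     ≡⟨ cong (λ l → _ ∷ _ ++ l) (pairs-edgesF-cong p p′ r refl) ⟩
  _ ∷ _ ++ pairs (edgesF _ p′ r)    ≡⟨ pairs-edgesF-∷ _ p′ t r ⟨
  pairs (edgesF _ p′ (node t ∷ r)) ∎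
  where open ≡-Reasoning

edgesF-left-bounds : ∀ k p ts {e} → e ∈ edgesF k p ts → k < LEdge.left e × LEdge.left e ≤ k + 2 * size ts
edgesF-left-bounds k p (node t ∷ r) (here refl) = n<1+n k , m<m+n k (s≤s z≤n)
edgesF-left-bounds k p (node t ∷ r) (there e∈) with ∈-++⁻ (edgesF (suc k) (suc k) t) e∈
... | inj₁ e∈t = let (lo , hi) = edgesF-left-bounds (suc k) (suc k) t e∈t in
  <-trans (n<1+n k) lo , ≤-trans hi (≤-trans (m≤m+n _ (suc (2 * size r))) (≤-reflexive (child-end k (size t) (size r))))
  where
  child-end : ∀ k t r → suc k + 2 * t + suc (2 * r) ≡ k + 2 * (suc t + r)
  child-end = solve-∀
... | inj₂ e∈r = let (lo , hi) = edgesF-left-bounds (k + 2 * suc (size t)) p r e∈r in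
  ≤-<-trans (m≤m+n k _) lo , ≤-trans hi (≤-reflexive (offset-after-tree k (size t) (size r)))

pairs-edgesF-bounds : ∀ k p ts {x} → x ∈ pairs (edgesF k p ts) → k < proj₁ x × proj₁ x ≤ k + 2 * size ts
pairs-edgesF-bounds k p ts x∈ with ∈-map⁻ endpoints x∈
... | e , e∈ , refl = edgesF-left-bounds k p ts e∈

-- Labels of the rotation  node (a ++ node c ∷ d) ∷ r ↦ node a ∷ (c ++ node d ∷ r)  of a forest
-- placed after label k, where A, C, D are the sizes of a, c, d.
module RotationLabels (k A C D : ℕ) where
  a-right : suc k + suc (2 * A) ≡ suc (suc k + 2 * A)
  a-right = solve (k ∷ A ∷ [])

  c-offset : suc (suc k + 2 * A) ≡ k + 2 * suc A
  c-offset = offset-after-node k A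

  d-left : suc (suc k + 2 * A) + suc (2 * C) ≡ suc (k + 2 * suc A + 2 * C)
  d-left = solve (k ∷ A ∷ C ∷ [])

  d-right : suc k + suc (2 * (A + (suc C + D))) ≡ suc (k + 2 * suc A + 2 * C) + suc (2 * D)
  d-right = solve (k ∷ A ∷ C ∷ D ∷ [])

  d-offset : suc k + 2 * A + 2 * suc C ≡ suc (k + 2 * suc A + 2 * C)
  d-offset = solve (k ∷ A ∷ C ∷ [])

  r-offset : k + 2 * suc (A + (suc C + D)) ≡ k + 2 * suc A + 2 * C + 2 * suc D
  r-offset = solve (k ∷ A ∷ C ∷ D ∷ [])

module Validity {ℓ : Level} (𝒜 : ComplementaryAlphabet ℓ) {m : ℕ}
                (P : Vec (ComplementaryAlphabet.Letter 𝒜) m) where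
  open ComplementaryAlphabet 𝒜 using (comp; comp-invol)

  Complementary : ℕ → ℕ → Set ℓ
  Complementary = ComplementaryAt 𝒜 P

  letterAt-complement-complement : ∀ {i j l} → Complementary i j → Complementary j l →
                                   letterAt 𝒜 P l ≡ letterAt 𝒜 P i
  letterAt-complement-complement (a , b , pᵢ , pⱼ , b≡ā) (b′ , c , pⱼ′ , pₗ , c≡b̄′) = begin
    letterAt 𝒜 P _  ≡⟨ pₗ ⟩
    just c           ≡⟨ cong just c≡b̄′ ⟩
    just (comp b′)   ≡⟨ cong (just ∘′ comp) (just-injective (trans (sym pⱼ′) pⱼ)) ⟩
    just (comp b)    ≡⟨ cong (just ∘′ comp) b≡ā ⟩
    just (comp (comp a)) ≡⟨ cong just (comp-invol a) ⟩
    just a           ≡⟨ pᵢ ⟨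
    letterAt 𝒜 P _  ∎
    where open ≡-Reasoning

  complementary-resp-letterAt : ∀ {i l j} → letterAt 𝒜 P l ≡ letterAt 𝒜 P i →
                                Complementary i j → Complementary l j
  complementary-resp-letterAt pₗ≡pᵢ (a , b , pᵢ , pⱼ , b≡ā) = a , b , trans pₗ≡pᵢ pᵢ , pⱼ , b≡ā

  -- Validity of a forest whose contour walk starts after label k.
  ValidF : ℕ → List PlaneTree → Set ℓ
  ValidF k []           = Lift ℓ ⊤
  ValidF k (node t ∷ r) =
    Complementary (suc k) (suc k + suc (2 * size t)) × ValidF (suc k) t × ValidF (k + 2 * suc (size t)) r

  ValidF-offset : ∀ {k k′ ts} → k ≡ k′ → ValidF k ts → ValidF k′ ts
  ValidF-offset refl v = v

  ValidF-++⁺ : ∀ {k} xs ys → ValidF k xs → ValidF (k + 2 * size xs) ys → ValidF k (xs ++ ys)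
  ValidF-++⁺ []            ys _              v-ys = ValidF-offset (+-identityʳ _) v-ys
  ValidF-++⁺ (node t ∷ xs) ys (c , v-t , v-xs) v-ys =
    c , v-t , ValidF-++⁺ xs ys v-xs (ValidF-offset (sym (offset-after-tree _ (size t) (size xs))) v-ys)

  ValidF-++⁻ : ∀ {k} xs ys → ValidF k (xs ++ ys) → ValidF k xs × ValidF (k + 2 * size xs) ys
  ValidF-++⁻ []            ys v = lift _ , ValidF-offset (sym (+-identityʳ _)) v
  ValidF-++⁻ (node t ∷ xs) ys (c , v-t , v) with ValidF-++⁻ xs ys v
  ... | v-xs , v-ys = (c , v-t , v-xs) , ValidF-offset (offset-after-tree _ (size t) (size xs)) v-ys

  ValidF⇒complementary : ∀ k p ts → ValidF k ts →
                         ∀ {e} → e ∈ edgesF k p ts → Complementary (LEdge.left e) (LEdge.right e)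
  ValidF⇒complementary k p (node t ∷ r) (c , _ , _) (here refl) = c
  ValidF⇒complementary k p (node t ∷ r) (_ , v-t , v-r) (there e∈) with ∈-++⁻ (edgesF (suc k) (suc k) t) e∈
  ... | inj₁ e∈t = ValidF⇒complementary (suc k) (suc k) t v-t e∈t
  ... | inj₂ e∈r = ValidF⇒complementary _ p r v-r e∈r

  complementary⇒ValidF : ∀ k p ts → (∀ {e} → e ∈ edgesF k p ts → Complementary (LEdge.left e) (LEdge.right e)) →
                         ValidF k ts
  complementary⇒ValidF k p []           _ = lift _
  complementary⇒ValidF k p (node t ∷ r) h =
    h (here refl) ,
    complementary⇒ValidF (suc k) (suc k) t (λ e∈ → h (there (∈-++⁺ˡ e∈))) ,
    complementary⇒ValidF _ p r (λ e∈ → h (there (∈-++⁺ʳ (edgesF (suc k) (suc k) t) e∈)))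

  ValidF-replaceChild : ∀ {k t t′ r} → size t′ ≡ size t → ValidF (suc k) t′ →
                        ValidF k (node t ∷ r) → ValidF k (node t′ ∷ r)
  ValidF-replaceChild {k} eq v-t′ (c , _ , v-r) =
    subst (λ s → Complementary (suc k) (suc k + suc (2 * s))) (sym eq) c , v-t′ ,
    ValidF-offset (cong (λ s → k + 2 * suc s) (sym eq)) v-r

  ValidF-rotate : ∀ {k} a c d r → Complementary (suc k) (suc k + suc (2 * size a)) →
                  ValidF k (node (a ++ node c ∷ d) ∷ r) → ValidF k (node a ∷ (c ++ node d ∷ r))
  ValidF-rotate {k} a c d r cₐ (c-aZ , v-aZ , v-r) with ValidF-++⁻ a (node c ∷ d) v-aZ
  ... | v-a , c-c , v-c , v-d =
    cₐ , v-a ,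
    ValidF-++⁺ c (node d ∷ r) (ValidF-offset c-offset v-c)
      (c-d , ValidF-offset d-offset v-d , ValidF-offset (trans (cong (λ s → k + 2 * suc s) size-aZ) r-offset) v-r)
    where
    open RotationLabels k (size a) (size c) (size d)
    size-aZ : size (a ++ node c ∷ d) ≡ size a + (suc (size c) + size d)
    size-aZ = size-++ a (node c ∷ d)
    c-d : Complementary (suc (k + 2 * suc (size a) + 2 * size c))
                        (suc (k + 2 * suc (size a) + 2 * size c) + suc (2 * size d))
    c-d = subst₂ Complementary d-left (trans (cong (λ s → suc k + suc (2 * s)) size-aZ) d-right)
            (complementary-resp-letterAt
              (letterAt-complement-complement (subst (Complementary (suc k)) a-right cₐ) c-c) c-aZ)

  Completion : ℕ → ℕ → ℕ → Set ℓ
  Completion s m n = Σ (List PlaneTree) λ W → ValidF (s + 2 * m) W × m + size W ≡ n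

  Completion-suc : ∀ {s h m n} → Completion (s + 2 * suc h) m n → Completion s (suc h + m) (suc h + n)
  Completion-suc {s} {h} {m} (W , v-W , m+W≡n) =
    W , ValidF-offset (offset-after-tree s h m) v-W , trans (+-assoc (suc h) m (size W)) (cong (suc h +_) m+W≡n)

  realign : ∀ {s x y Y′} → Complementary (suc s) (suc s + suc (2 * size x)) → ValidF (suc s) x →
            ValidF s (node y ∷ Y′) → Completion (suc s) (size x) (size y) →
            Σ (List PlaneTree) λ V → ValidF s (node x ∷ V) × suc (size x) + size V ≡ suc (size y) + size Y′
  realign {x = x} {y} {Y′} cₓ vₓ v-Y ([] , _ , x+0≡y) =
    Y′ , ValidF-replaceChild x≡y vₓ v-Y , cong (λ s → suc s + size Y′) x≡y
    where
    x≡y : size x ≡ size y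
    x≡y = trans (sym (+-identityʳ (size x))) x+0≡y
  realign {x = x} {y} {Y′} cₓ vₓ v-Y (node c ∷ d , v-Z , x+Z≡y) =
    c ++ node d ∷ Y′ ,
    ValidF-rotate x c d Y′ cₓ (ValidF-replaceChild xZ≡y (ValidF-++⁺ x (node c ∷ d) vₓ v-Z) v-Y) ,
    trans (size-rotate x c d Y′) (cong (λ s → suc s + size Y′) xZ≡y)
    where
    xZ≡y : size (x ++ node c ∷ d) ≡ size y
    xZ≡y = trans (size-++ x (node c ∷ d)) x+Z≡y

  completion : ∀ {s X Y} → Acc _<_ (size Y) → ValidF s X → ValidF s Y → size X ≤ size Y →
               Completion s (size X) (size Y)
  completion {X = []} {Y} _ _ v-Y _ = Y , ValidF-offset (sym (+-identityʳ _)) v-Y , refl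
  completion {X = node _ ∷ _} {[]} _ _ _ ()
  completion {s} {node x ∷ X′} {node y ∷ Y′} (acc rec) v-X@(cₓ , vₓ , v-X′) v-Y@(c-y , v-y , v-Y′) X≤Y
    with ≤-total (size x) (size y)
  ... | inj₁ x≤y =
    let V , (_ , _ , v-V) , xV≡Y = realign cₓ vₓ v-Y (completion (rec (child<size refl)) vₓ v-y x≤y)
        V<Y = rest<size xV≡Y
        X′≤V = +-cancelˡ-≤ (suc (size x)) (size X′) (size V) (≤-trans X≤Y (≤-reflexive (sym xV≡Y)))
    in subst (Completion s _) xV≡Y (Completion-suc (completion (rec V<Y) v-X′ v-V X′≤V))
  ... | inj₂ y≤x =
    let V , (_ , _ , v-V) , yV≡X = realign c-y v-y v-X (completion (rec (<-≤-trans (child<size refl) X≤Y)) v-y vₓ y≤x)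
        V≤Y′ = +-cancelˡ-≤ (suc (size y)) (size V) (size Y′) (≤-trans (≤-reflexive yV≡X) X≤Y)
    in subst (λ m → Completion s m (suc (size y) + size Y′)) yV≡X
         (Completion-suc (completion (rec (rest<size refl)) v-V v-Y′ V≤Y′))

∉-++⁺ : ∀ {A : Set} {x : A} xs {ys} → x ∉ xs → x ∉ ys → x ∉ xs ++ ys
∉-++⁺ xs x∉xs x∉ys x∈ = Sum.[ x∉xs , x∉ys ] (∈-++⁻ xs x∈)

∉-by-left : ∀ {l r} {xs : List (ℕ × ℕ)} → (∀ {y} → y ∈ xs → proj₁ y ≢ l) → (l , r) ∉ xs
∉-by-left left≢ x∈ = left≢ x∈ refl

Disjoint-by-left : ∀ {xs ys : List (ℕ × ℕ)} l →
                   (∀ {x} → x ∈ xs → l < proj₁ x) → (∀ {y} → y ∈ ys → proj₁ y ≤ l) → Disjoint xs ys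
Disjoint-by-left l above below (v∈xs , v∈ys) = <⇒≱ (above v∈xs) (below v∈ys)

-- Unlike Replace, an exchange survives adding pairs on either side of both lists.
record Exchange (PS PT : List (ℕ × ℕ)) (a b c d : ℕ × ℕ) : Set where
  field
    kept   : List (ℕ × ℕ)
    source : PS ↭ a ∷ b ∷ kept
    target : PT ↭ c ∷ d ∷ kept
    a∉kept : a ∉ kept
    b∉kept : b ∉ kept

  replaced∈source : a ∈ PS × b ∈ PS
  replaced∈source = ∈-resp-↭ (↭-sym source) (here refl) , ∈-resp-↭ (↭-sym source) (there (here refl))

Exchange⇒Replace : ∀ {S T a b c d} → Exchange (edgePairs S) (edgePairs T) a b c d → Replace S a b c d T
Exchange⇒Replace {S} {T} {a} {b} {c} {d} ex x = mk⇔ to from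
  where
  open Exchange ex
  to : x ∈ edgePairs T → (x ∈ edgePairs S × x ≢ a × x ≢ b) ⊎ x ≡ c ⊎ x ≡ d
  to x∈T with ∈-resp-↭ target x∈T
  ... | here x≡c             = inj₂ (inj₁ x≡c)
  ... | there (here x≡d)     = inj₂ (inj₂ x≡d)
  ... | there (there x∈kept) =
    inj₁ (∈-resp-↭ (↭-sym source) (there (there x∈kept)) ,
          (λ { refl → a∉kept x∈kept }) , (λ { refl → b∉kept x∈kept }))
  from : (x ∈ edgePairs S × x ≢ a × x ≢ b) ⊎ x ≡ c ⊎ x ≡ d → x ∈ edgePairs T
  from (inj₂ (inj₁ x≡c)) = ∈-resp-↭ (↭-sym target) (here x≡c)
  from (inj₂ (inj₂ x≡d)) = ∈-resp-↭ (↭-sym target) (there (here x≡d))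
  from (inj₁ (x∈S , x≢a , x≢b)) with ∈-resp-↭ source x∈S
  ... | here x≡a             = ⊥-elim (x≢a x≡a)
  ... | there (here x≡b)     = ⊥-elim (x≢b x≡b)
  ... | there (there x∈kept) = ∈-resp-↭ (↭-sym target) (there (there x∈kept))

Exchange-++ˡ : ∀ Q {PS PT a b c d} → Disjoint PS Q → Exchange PS PT a b c d →
               Exchange (Q ++ PS) (Q ++ PT) a b c d
Exchange-++ˡ Q {a = a} {b} {c} {d} disjoint ex = record
  { kept   = Q ++ kept
  ; source = ↭-trans (++⁺ˡ Q source) (shifts Q (a ∷ b ∷ []))
  ; target = ↭-trans (++⁺ˡ Q target) (shifts Q (c ∷ d ∷ []))
  ; a∉kept = ∉-++⁺ Q (λ a∈Q → disjoint (proj₁ replaced∈source , a∈Q)) a∉kept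
  ; b∉kept = ∉-++⁺ Q (λ b∈Q → disjoint (proj₂ replaced∈source , b∈Q)) b∉kept
  }
  where open Exchange ex

Exchange-++ʳ : ∀ R {PS PT a b c d} → Disjoint PS R → Exchange PS PT a b c d →
               Exchange (PS ++ R) (PT ++ R) a b c d
Exchange-++ʳ R disjoint ex = record
  { kept   = kept ++ R
  ; source = ++⁺ʳ R source
  ; target = ++⁺ʳ R target
  ; a∉kept = ∉-++⁺ kept a∉kept (λ a∈R → disjoint (proj₁ replaced∈source , a∈R))
  ; b∉kept = ∉-++⁺ kept b∉kept (λ b∈R → disjoint (proj₂ replaced∈source , b∈R))
  }
  where open Exchange ex

Exchange-rotation : ∀ α β γ δ PA PC PD PR → α ∉ PA ++ PC ++ PD ++ PR → β ∉ PA ++ PC ++ PD ++ PR →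
                    Exchange (α ∷ (PA ++ β ∷ PC ++ PD) ++ PR) (γ ∷ PA ++ PC ++ δ ∷ PD ++ PR) α β γ δ
Exchange-rotation α β γ δ PA PC PD PR α∉ β∉ = record
  { kept   = PA ++ PC ++ PD ++ PR
  ; source = prep α (↭-trans (↭-reflexive reassociate) (shift β PA (PC ++ PD ++ PR)))
  ; target = prep γ (↭-trans (++⁺ˡ PA (shift δ PC (PD ++ PR))) (shift δ PA (PC ++ PD ++ PR)))
  ; a∉kept = α∉
  ; b∉kept = β∉
  }
  where
  reassociate : (PA ++ β ∷ PC ++ PD) ++ PR ≡ PA ++ β ∷ PC ++ PD ++ PR
  reassociate = trans (++-assoc PA (β ∷ PC ++ PD) PR) (cong (λ l → PA ++ β ∷ l) (++-assoc PC PD PR))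

EdgesShareVertexIn : List LEdge → ℕ × ℕ → ℕ × ℕ → Set
EdgesShareVertexIn ES (i , j) (i′ , j′) = Σ ℕ λ p → Σ ℕ λ p′ →
  ledge i j p ∈ ES × ledge i′ j′ p′ ∈ ES × ShareVertex (ledge i j p) (ledge i′ j′ p′)

record Step (ES ET : List LEdge) (a b c d : ℕ × ℕ) : Set where
  constructor _,_
  field
    shared   : EdgesShareVertexIn ES a b
    exchange : Exchange (pairs ES) (pairs ET) a b c d

Move : List LEdge → List LEdge → Set
Move ES ET = Σ ℕ λ i → Σ ℕ λ j → Σ ℕ λ i′ → Σ ℕ λ j′ → i < j × j < i′ × i′ < j′ ×
  (Step ES ET (i , j) (i′ , j′) (i , j′) (j , i′) ⊎ Step ES ET (i , j′) (j , i′) (i , j) (i′ , j′))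

Move-map : ∀ {ES ET ES′ ET′} → (∀ {a b c d} → Step ES ET a b c d → Step ES′ ET′ a b c d) →
           Move ES ET → Move ES′ ET′
Move-map f (i , j , i′ , j′ , i<j , j<i′ , i′<j′ , step) = i , j , i′ , j′ , i<j , j<i′ , i′<j′ , Sum.map f f step

Move⇒LocalMove : ∀ {ts us} → Move (edgesF 0 0 ts) (edgesF 0 0 us) → LocalMove (node ts) (node us)
Move⇒LocalMove {ts} {us} (i , j , i′ , j′ , i<j , j<i′ , i′<j′ , step) =
  i , j , i′ , j′ , i<j , j<i′ , i′<j′ , Sum.map toDefs toDefs step
  where
  toDefs : ∀ {a b c d} → Step (edgesF 0 0 ts) (edgesF 0 0 us) a b c d →
           EdgesShareVertex (node ts) a b × Replace (node ts) a b c d (node us)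
  toDefs (shared , exchange) = shared , Exchange⇒Replace exchange

Step-++ˡ : ∀ Q {ES ET a b c d} → Disjoint (pairs ES) (pairs Q) → Step ES ET a b c d →
           Step (Q ++ ES) (Q ++ ET) a b c d
Step-++ˡ Q {ES} {ET} disjoint ((p , p′ , a∈ , b∈ , shared) , ex) =
  (p , p′ , ∈-++⁺ʳ Q a∈ , ∈-++⁺ʳ Q b∈ , shared) ,
  subst₂ (λ PS PT → Exchange PS PT _ _ _ _) (sym (map-++ endpoints Q ES)) (sym (map-++ endpoints Q ET))
    (Exchange-++ˡ (pairs Q) disjoint ex)

Step-++ʳ : ∀ R {ES ET a b c d} → Disjoint (pairs ES) (pairs R) → Step ES ET a b c d →
           Step (ES ++ R) (ET ++ R) a b c d
Step-++ʳ R {ES} {ET} disjoint ((p , p′ , a∈ , b∈ , shared) , ex) =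
  (p , p′ , ∈-++⁺ˡ a∈ , ∈-++⁺ˡ b∈ , shared) ,
  subst₂ (λ PS PT → Exchange PS PT _ _ _ _) (sym (map-++ endpoints ES R)) (sym (map-++ endpoints ET R))
    (Exchange-++ʳ (pairs R) disjoint ex)

∈-pairs-++⁻ : ∀ ES {FS x} → x ∈ pairs (ES ++ FS) → x ∈ pairs ES ⊎ x ∈ pairs FS
∈-pairs-++⁻ ES {FS} x∈ = ∈-++⁻ (pairs ES) (subst (_ ∈_) (map-++ endpoints ES FS) x∈)

move-under-node : ∀ k p t {r r′} →
                  Move (edgesF (k + 2 * suc (size t)) p r) (edgesF (k + 2 * suc (size t)) p r′) →
                  Move (edgesF k p (node t ∷ r)) (edgesF k p (node t ∷ r′))
move-under-node k p t {r} = Move-map (Step-++ˡ Q disjoint)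
  where
  Q = ledge (suc k) (suc k + suc (2 * size t)) p ∷ edgesF (suc k) (suc k) t
  node-below : ∀ {y} → y ∈ pairs Q → proj₁ y ≤ k + 2 * suc (size t)
  node-below (here refl) = m<m+n k (s≤s z≤n)
  node-below (there y∈t) =
    ≤-trans (proj₂ (pairs-edgesF-bounds (suc k) (suc k) t y∈t)) (≤-trans (n≤1+n _) (≤-reflexive (offset-after-node k (size t))))
  disjoint : Disjoint (pairs (edgesF (k + 2 * suc (size t)) p r)) (pairs Q)
  disjoint = Disjoint-by-left (k + 2 * suc (size t)) (λ x∈ → proj₁ (pairs-edgesF-bounds _ p r x∈)) node-below

move-into-child : ∀ k p {t t′} r → size t ≡ size t′ →
                  Move (edgesF (suc k) (suc k) t) (edgesF (suc k) (suc k) t′) →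
                  Move (edgesF k p (node t ∷ r)) (edgesF k p (node t′ ∷ r))
move-into-child k p {t} {t′} r t≡t′ =
  subst (λ s → Move (edgesF k p (node t ∷ r))
                    (ledge (suc k) (suc k + suc (2 * s)) p ∷ edgesF (suc k) (suc k) t′ ++ edgesF (k + 2 * suc s) p r)) t≡t′
  ∘′ Move-map (Step-++ˡ (e ∷ []) edge-disjoint ∘′ Step-++ʳ R tail-disjoint)
  where
  e = ledge (suc k) (suc k + suc (2 * size t)) p
  R = edgesF (k + 2 * suc (size t)) p r
  R-above : ∀ {x} → x ∈ pairs R → suc k + 2 * size t < proj₁ x
  R-above x∈ = <-trans (≤-reflexive (offset-after-node k (size t))) (proj₁ (pairs-edgesF-bounds _ p r x∈))
  tail-disjoint : Disjoint (pairs (edgesF (suc k) (suc k) t)) (pairs R)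
  tail-disjoint (x∈t , x∈R) =
    Disjoint-by-left (suc k + 2 * size t) R-above (λ y∈t → proj₂ (pairs-edgesF-bounds _ _ t y∈t)) (x∈R , x∈t)
  edge-disjoint : Disjoint (pairs (edgesF (suc k) (suc k) t ++ R)) (pairs (e ∷ []))
  edge-disjoint = Disjoint-by-left (suc k) child-or-tail-above λ { (here refl) → ≤-refl }
    where
    child-or-tail-above : ∀ {x} → x ∈ pairs (edgesF (suc k) (suc k) t ++ R) → suc k < proj₁ x
    child-or-tail-above x∈ with ∈-pairs-++⁻ (edgesF (suc k) (suc k) t) x∈
    ... | inj₁ x∈t = proj₁ (pairs-edgesF-bounds _ _ t x∈t)
    ... | inj₂ x∈R = ≤-<-trans (m≤m+n (suc k) _) (R-above x∈R)

module Rotation (k p : ℕ) (a c d r : List PlaneTree) where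
  open RotationLabels k (size a) (size c) (size d)

  before after : List PlaneTree
  before = node (a ++ node c ∷ d) ∷ r
  after  = node a ∷ (c ++ node d ∷ r)

  o q i j i′ j′ : ℕ
  o  = suc k + 2 * size a
  q  = k + 2 * suc (size a)
  i  = suc k
  j  = suc o
  i′ = suc o + suc (2 * size c)
  j′ = suc k + suc (2 * size (a ++ node c ∷ d))

  PA PC PD PR : List (ℕ × ℕ)
  PA = pairs (edgesF (suc k) (suc k) a)
  PC = pairs (edgesF (suc o) (suc o) c)
  PD = pairs (edgesF (o + 2 * suc (size c)) (suc k) d)
  PR = pairs (edgesF (k + 2 * suc (size (a ++ node c ∷ d))) p r)

  j′-after : j′ ≡ suc (q + 2 * size c) + suc (2 * size d)
  j′-after = trans (cong (λ s → suc k + suc (2 * s)) (size-++ a (node c ∷ d))) d-right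

  r-after : k + 2 * suc (size (a ++ node c ∷ d)) ≡ q + 2 * size c + 2 * suc (size d)
  r-after = trans (cong (λ s → k + 2 * suc s) (size-++ a (node c ∷ d))) r-offset

  i<j : i < j
  i<j = s≤s (s≤s (m≤m+n k _))

  j<i′ : j < i′
  j<i′ = m<m+n j (s≤s z≤n)

  i′<j′ : i′ < j′
  i′<j′ = subst₂ _<_ (sym d-left) (sym j′-after) (m<m+n _ (s≤s z≤n))

  shared : EdgesShareVertexIn (edgesF k p before) (i , j′) (j , i′)
  shared = p , suc k , here refl , there (∈-++⁺ˡ c-edge∈) , inj₂ (inj₂ (inj₁ refl))
    where
    c-edge∈ : ledge j i′ (suc k) ∈ edgesF (suc k) (suc k) (a ++ node c ∷ d)
    c-edge∈ = subst (ledge j i′ (suc k) ∈_) (sym (edgesF-++ (suc k) (suc k) a (node c ∷ d)))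
                    (∈-++⁺ʳ (edgesF (suc k) (suc k) a) (here refl))

  pairs-before : pairs (edgesF k p before) ≡ (i , j′) ∷ (PA ++ (j , i′) ∷ PC ++ PD) ++ PR
  pairs-before = trans (pairs-edgesF-∷ k p (a ++ node c ∷ d) r)
    (cong (λ l → (i , j′) ∷ l ++ PR)
      (trans (pairs-edgesF-++ (suc k) (suc k) a (node c ∷ d)) (cong (PA ++_) (pairs-edgesF-∷ o (suc k) c d))))

  pairs-after-a : pairs (edgesF q p (c ++ node d ∷ r)) ≡ PC ++ (i′ , j′) ∷ PD ++ PR
  pairs-after-a = trans (pairs-edgesF-++ q p c (node d ∷ r))
    (cong₂ _++_ (pairs-edgesF-cong p (suc o) c (sym c-offset))
      (trans (pairs-edgesF-∷ (q + 2 * size c) p d r)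
        (cong₂ _∷_ (cong₂ _,_ (sym d-left) (sym j′-after))
          (cong₂ _++_ (pairs-edgesF-cong _ (suc k) d (sym d-offset)) (pairs-edgesF-cong p p r (sym r-after))))))

  pairs-after : pairs (edgesF k p after) ≡ (i , j) ∷ PA ++ PC ++ (i′ , j′) ∷ PD ++ PR
  pairs-after = trans (pairs-edgesF-∷ k p a (c ++ node d ∷ r))
    (cong₂ (λ x l → x ∷ PA ++ l) (cong (i ,_) a-right) pairs-after-a)

  kept-left : ∀ {y} → y ∈ PA ++ PC ++ PD ++ PR → (i < proj₁ y × proj₁ y ≤ o) ⊎ q < proj₁ y
  kept-left y∈ with ∈-++⁻ PA y∈
  ... | inj₁ y∈a = inj₁ (pairs-edgesF-bounds (suc k) (suc k) a y∈a)
  ... | inj₂ y∈cdr = inj₂ (proj₁ (pairs-edgesF-bounds q p (c ++ node d ∷ r)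
                                   (subst (_ ∈_) (sym pairs-after-a) (skip-δ y∈cdr))))
    where
    skip-δ : ∀ {y} → y ∈ PC ++ PD ++ PR → y ∈ PC ++ (i′ , j′) ∷ PD ++ PR
    skip-δ y∈ = Sum.[ ∈-++⁺ˡ , ∈-++⁺ʳ PC ∘′ there ] (∈-++⁻ PC y∈)

  i∉kept : (i , j′) ∉ PA ++ PC ++ PD ++ PR
  i∉kept = ∉-by-left λ y∈ →
    Sum.[ (λ (i<y , _) → >⇒≢ i<y) , (λ q<y → >⇒≢ (≤-<-trans (m<m+n k (s≤s z≤n)) q<y)) ] (kept-left y∈)

  j∉kept : (j , i′) ∉ PA ++ PC ++ PD ++ PR
  j∉kept = ∉-by-left λ {y} y∈ →
    Sum.[ (λ (_ , y≤o) → <⇒≢ (s≤s y≤o)) , (λ q<y → >⇒≢ (subst (_< proj₁ y) (sym c-offset) q<y)) ] (kept-left y∈)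

  rotation-move : Move (edgesF k p before) (edgesF k p after)
  rotation-move = i , j , i′ , j′ , i<j , j<i′ , i′<j′ , inj₂ (shared ,
    subst₂ (λ PS PT → Exchange PS PT (i , j′) (j , i′) (i , j) (i′ , j′)) (sym pairs-before) (sym pairs-after)
      (Exchange-rotation (i , j′) (j , i′) (i , j) (i′ , j′) PA PC PD PR i∉kept j∉kept))

module Connectivity {ℓ : Level} (𝒜 : ComplementaryAlphabet ℓ) {m : ℕ}
                    (P : Vec (ComplementaryAlphabet.Letter 𝒜) m) where
  open Validity 𝒜 P

  AdjacentF : ℕ → ℕ → ℕ → List PlaneTree → List PlaneTree → Set ℓ
  AdjacentF k p n ts us =
    (size ts ≡ n × ValidF k ts) × (size us ≡ n × ValidF k us) ×
    (Move (edgesF k p ts) (edgesF k p us) ⊎ Move (edgesF k p us) (edgesF k p ts))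

  AdjacentF-sym : ∀ {k p n ts us} → AdjacentF k p n ts us → AdjacentF k p n us ts
  AdjacentF-sym (v-ts , v-us , mv) = v-us , v-ts , Sum.swap mv

  path-under-node : ∀ {k p t n n′ r r′} → suc (size t) + n ≡ n′ →
                    Complementary (suc k) (suc k + suc (2 * size t)) → ValidF (suc k) t →
                    Star (AdjacentF (k + 2 * suc (size t)) p n) r r′ → Star (AdjacentF k p n′) (node t ∷ r) (node t ∷ r′)
  path-under-node {k} {p} {t} {n} refl cₜ vₜ = gmap (node t ∷_) step
    where
    step : ∀ {r r′} → AdjacentF (k + 2 * suc (size t)) p n r r′ → AdjacentF k p (suc (size t) + n) (node t ∷ r) (node t ∷ r′)
    step ((r≡ , v-r) , (r′≡ , v-r′) , mv) =
      (cong (suc (size t) +_) r≡ , cₜ , vₜ , v-r) , (cong (suc (size t) +_) r′≡ , cₜ , vₜ , v-r′) ,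
      Sum.map (move-under-node k p t) (move-under-node k p t) mv

  path-into-child : ∀ {k p s n r t t′} → suc s + size r ≡ n →
                    Complementary (suc k) (suc k + suc (2 * s)) → ValidF (k + 2 * suc s) r →
                    Star (AdjacentF (suc k) (suc k) s) t t′ → Star (AdjacentF k p n) (node t ∷ r) (node t′ ∷ r)
  path-into-child {k} {p} {s} {n} {r} sr≡n c v-r = gmap (λ t → node t ∷ r) step
    where
    valid : ∀ {t} → size t ≡ s → ValidF (suc k) t → size (node t ∷ r) ≡ n × ValidF k (node t ∷ r)
    valid refl vₜ = sr≡n , c , vₜ , v-r
    step : ∀ {t t′} → AdjacentF (suc k) (suc k) s t t′ → AdjacentF k p n (node t ∷ r) (node t′ ∷ r)
    step ((t≡ , vₜ) , (t′≡ , vₜ′) , mv) =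
      valid t≡ vₜ , valid t′≡ vₜ′ ,
      Sum.map (move-into-child k p r (trans t≡ (sym t′≡))) (move-into-child k p r (trans t′≡ (sym t≡))) mv

  mutual
    connected : ∀ {n} → Acc _<_ n → ∀ {k p ts us} → size ts ≡ n → size us ≡ n →
                ValidF k ts → ValidF k us → Star (AdjacentF k p n) ts us
    connected _ {ts = []}         {[]}         _    _    _    _    = ε
    connected _ {ts = []}         {node _ ∷ _} refl ()   _    _
    connected _ {ts = node _ ∷ _} {[]}         refl ()   _    _
    connected acc-n {ts = node a ∷ _} {node b ∷ _} tsₙ usₙ v-ts v-us with ≤-total (size a) (size b)
    ... | inj₁ a≤b = connected-≤ acc-n tsₙ usₙ a≤b v-ts v-us
    ... | inj₂ b≤a = reverse AdjacentF-sym (connected-≤ acc-n usₙ tsₙ b≤a v-us v-ts)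

    connected-≤ : ∀ {n} → Acc _<_ n → ∀ {k p a ts b us} → suc (size a) + size ts ≡ n → suc (size b) + size us ≡ n →
                  size a ≤ size b → ValidF k (node a ∷ ts) → ValidF k (node b ∷ us) →
                  Star (AdjacentF k p n) (node a ∷ ts) (node b ∷ us)
    connected-≤ (acc rec) {k} {p} {a} {ts} {b} {us} tsₙ usₙ a≤b (cₐ , vₐ , v-ts) v-bus@(c-b , v-b , v-us)
      with completion (<-wellFounded (size b)) vₐ v-b a≤b
    ... | [] , _ , a+0≡b =
      path-into-child tsₙ cₐ v-ts (connected (rec (child<size tsₙ)) refl (sym a≡b) vₐ v-b) ◅◅
      path-under-node (trans (cong (λ s → suc s + size ts) (sym a≡b)) tsₙ) c-b v-b
        (connected (rec (rest<size tsₙ)) refl us≡ts (ValidF-offset (cong (λ s → k + 2 * suc s) a≡b) v-ts) v-us)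
      where
      a≡b : size a ≡ size b
      a≡b = trans (sym (+-identityʳ (size a))) a+0≡b
      us≡ts : size us ≡ size ts
      us≡ts = +-cancelˡ-≡ (suc (size b)) (size us) (size ts) (trans usₙ (trans (sym tsₙ) (cong (λ s → suc s + size ts) a≡b)))
    ... | node c ∷ d , v-Z , a+Z≡b =
      path-under-node tsₙ cₐ vₐ (connected (rec (rest<size tsₙ)) refl V≡ts v-ts v-V) ◅◅
      ((aV≡n , v-aV) , (aZus≡n , v-aZus) , inj₂ (Rotation.rotation-move k p a c d us)) ◅
      path-into-child usₙ c-b v-us (connected (rec (child<size usₙ)) aZ≡b refl v-aZ v-b)
      where
      aZ≡b : size (a ++ node c ∷ d) ≡ size b
      aZ≡b = trans (size-++ a (node c ∷ d)) a+Z≡b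
      v-aZ : ValidF (suc k) (a ++ node c ∷ d)
      v-aZ = ValidF-++⁺ a (node c ∷ d) vₐ v-Z
      v-aZus : ValidF k (node (a ++ node c ∷ d) ∷ us)
      v-aZus = ValidF-replaceChild aZ≡b v-aZ v-bus
      aZus≡n : suc (size (a ++ node c ∷ d)) + size us ≡ _
      aZus≡n = trans (cong (λ s → suc s + size us) aZ≡b) usₙ
      v-aV : ValidF k (node a ∷ (c ++ node d ∷ us))
      v-aV = ValidF-rotate a c d us cₐ v-aZus
      v-V = proj₂ (proj₂ v-aV)
      aV≡n : suc (size a) + size (c ++ node d ∷ us) ≡ _
      aV≡n = trans (size-rotate a c d us) aZus≡n
      V≡ts : size (c ++ node d ∷ us) ≡ size ts
      V≡ts = +-cancelˡ-≡ (suc (size a)) _ _ (trans aV≡n (sym tsₙ))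

module _ {ℓ : Level} (𝒜 : ComplementaryAlphabet ℓ) (n : ℕ)
         (P : Vec (ComplementaryAlphabet.Letter 𝒜) (2 * n)) where
  open Validity 𝒜 P
  open Connectivity 𝒜 P

  Valid⇒ValidF : ∀ {ts} → Valid 𝒜 n P (node ts) → size ts ≡ n × ValidF 0 ts
  Valid⇒ValidF {ts} (tsₙ , complementary) =
    tsₙ , complementary⇒ValidF 0 0 ts (λ e∈ → complementary (∈-map⁺ endpoints e∈))

  ValidF⇒Valid : ∀ {ts} → size ts ≡ n × ValidF 0 ts → Valid 𝒜 n P (node ts)
  ValidF⇒Valid {ts} (tsₙ , v-ts) = tsₙ , complementary
    where
    complementary : ∀ {i j} → (i , j) ∈ edgePairs (node ts) → Complementary i j
    complementary x∈ with ∈-map⁻ endpoints x∈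
    ... | _ , e∈ , refl = ValidF⇒complementary 0 0 ts v-ts e∈

  AdjacentF⇒Adjacent𝒢 : ∀ {ts us} → AdjacentF 0 0 n ts us → Adjacent𝒢 𝒜 n P (node ts) (node us)
  AdjacentF⇒Adjacent𝒢 (v-ts , v-us , mv) = ValidF⇒Valid v-ts , ValidF⇒Valid v-us , Sum.map Move⇒LocalMove Move⇒LocalMove mv

mainTheorem3 : ∀ {ℓ : Level} (𝒜 : ComplementaryAlphabet ℓ) (n : ℕ)
                 (P : Vec (ComplementaryAlphabet.Letter 𝒜) (2 * n)) →
                 Connected𝒢 𝒜 n P
mainTheorem3 𝒜 n P (node ts) (node us) valid-S valid-T =
  let tsₙ , v-ts = Valid⇒ValidF 𝒜 n P valid-S
      usₙ , v-us = Valid⇒ValidF 𝒜 n P valid-T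
  in gmap node (AdjacentF⇒Adjacent𝒢 𝒜 n P) (Connectivity.connected 𝒜 P (<-wellFounded n) tsₙ usₙ v-ts v-us)
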